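{- Consider an ECO-system with axiom $(s_0)$ whose rules are $(k)\leadsto (e^{[0]}_1(k))\cdots(e^{[0]}_k(k))$ if $k$ is even and $(k)\leadsto (e^{[1]}_1(k))\cdots(e^{[1]}_k(k))$ if $k$ is odd. Let $\sigma_0(k)=\sum_{i=1}^k e^{[0]}_i(k)$ and $\sigma_1(k)=\sum_{i=1}^k e^{[1]}_i(k)$. Assume that (i) $\sigma_0$ and $\sigma_1$ are affine with the same leading coefficient: $\sigma_0(k)=\alpha k+\beta_0$ and $\sigma_1(k)=\alpha k+\beta_1$; and (ii) there is an integer $m\ge0$ such that exactly $m$ odd labels occur in the right-hand side of each rule. Let $s_1$ be the sum of the labels of the children of the root (i.e. the sum of the labels at level $1$). Then the generating function $F(z)=\sum_{n\ge0}f_nz^n$ of the system is $$F(z)=\frac{1+(s_0-\alpha)z+(s_1-\alpha s_0-\beta_0)z^2}{1-\alpha z-\beta_0 z^2-m(\beta_1-\beta_0)z^3}.$$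
   Context: An ECO-system $[(s_0),\ \{(k)\leadsto (e_1(k))\cdots(e_k(k))\}]$ consists of a positive integer axiom $s_0$ and, for each positive integer label $k$, a list of $k$ positive integers $e_1(k),\dots,e_k(k)$. Its generating tree is the rooted plane tree whose root is labeled $s_0$ and in which every node labeled $k$ has exactly $k$ children, labeled $e_1(k),\dots,e_k(k)$. The root is at level $0$; $f_n$ denotes the number of nodes at level $n$ (so $f_0=1$), and $F(z)=\sum_{n\ge0} f_n z^n$. -}

module Defs where

open import Data.Nat using (ℕ; zero; suc; _%_)
open import Data.Bool using (if_then_else_)
open import Data.Nat using (_≡ᵇ_)
open import Data.Integer as ℤ using (ℤ; +_)
open import Data.List using (List; []; _∷_; length; concatMap; upTo; map)
open import Data.Vec using (Vec; toList)
open import Relation.Binary.PropositionalEquality using (_≡_)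

Even : ℕ → Set
Even k = k % 2 ≡ 0

Odd : ℕ → Set
Odd k = k % 2 ≡ 1

rule : (e0 e1 : (k : ℕ) → Vec ℕ k) → (k : ℕ) → List ℕ
rule e0 e1 k = if (k % 2) ≡ᵇ 0 then toList (e0 k) else toList (e1 k)

level : (s0 : ℕ) (e0 e1 : (k : ℕ) → Vec ℕ k) → ℕ → List ℕ
level s0 e0 e1 zero    = s0 ∷ []
level s0 e0 e1 (suc n) = concatMap (rule e0 e1) (level s0 e0 e1 n)

f : (s0 : ℕ) (e0 e1 : (k : ℕ) → Vec ℕ k) → ℕ → ℕ
f s0 e0 e1 n = length (level s0 e0 e1 n)

sumℕ : List ℕ → ℕ
sumℕ []       = 0
sumℕ (x ∷ xs) = x ℕ.+ sumℕ xs
  where import Data.Nat as ℕ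

countOdd : List ℕ → ℕ
countOdd []       = 0
countOdd (x ∷ xs) = (x % 2) Data.Nat.+ countOdd xs
  where import Data.Nat

Series : Set
Series = ℕ → ℤ

sumℤ : List ℤ → ℤ
sumℤ []       = + 0
sumℤ (x ∷ xs) = x ℤ.+ sumℤ xs

_⊛_ : Series → Series → Series
(a ⊛ b) n = sumℤ (map (λ i → a i ℤ.* b (n Data.Nat.∸ i)) (upTo (suc n)))
  where import Data.Nat

poly : ℤ → ℤ → ℤ → ℤ → Series
poly c0 c1 c2 c3 0 = c0
poly c0 c1 c2 c3 1 = c1
poly c0 c1 c2 c3 2 = c2
poly c0 c1 c2 c3 3 = c3
poly c0 c1 c2 c3 (suc (suc (suc (suc _)))) = + 0

F : (s0 : ℕ) (e0 e1 : (k : ℕ) → Vec ℕ k) → Series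
F s0 e0 e1 n = + (f s0 e0 e1 n)

module Submission where

-- Each node labelled k has k children, so f (n + 1) is the label sum at level n.
-- Summing hypothesis (i) over the nodes of level n, the label sum at level n + 1 is
-- α · (label sum at level n) + β₀ f n + (β₁ − β₀) · (number of odd labels at level n),
-- and by (ii) level n + 1 carries exactly m f n odd labels.  Hence
--   f (n + 3) = α f (n + 2) + β₀ f (n + 1) + m (β₁ − β₀) f n,
-- so multiplying F by the denominator kills every coefficient from z³ on; the first
-- three coefficients are computed from f 0 = 1, f 1 = s₀ and f 2 = s₁.

open import Defs
open import Data.Nat using (ℕ; _≤_; _%_)
open import Data.Integer using (ℤ; +_; _+_; _-_; _*_; -_)
open import Data.Vec using (Vec; toList)
open import Data.List.Relation.Unary.All using (All)
open import Relation.Binary.PropositionalEquality using (_≡_)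

open import Data.Nat as ℕ using (zero; suc; s≤s; z≤n; _<_; _∸_)
import Data.Nat.Properties as ℕ
open import Data.Nat.DivMod using (m%n<n)
import Data.Integer.Properties as ℤ
open import Data.Integer.Tactic.RingSolver using (solve-∀)
open import Data.List using (List; []; _∷_; _++_; _∷ʳ_; length; concatMap; map; upTo; applyUpTo)
import Data.List.Properties as List
import Data.List.Relation.Unary.All as All
import Data.List.Relation.Unary.All.Properties as All
open import Data.Bool using (if_then_else_)
open import Data.Sum using (_⊎_; inj₁; inj₂)
open import Data.Vec.Properties using (length-toList)
open import Relation.Binary.PropositionalEquality
  using (refl; cong; cong₂; sym; trans; subst; module ≡-Reasoning)

sumℕ-++ : ∀ xs ys → sumℕ (xs ++ ys) ≡ sumℕ xs ℕ.+ sumℕ ys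
sumℕ-++ []       ys = refl
sumℕ-++ (x ∷ xs) ys = trans (cong (x ℕ.+_) (sumℕ-++ xs ys)) (sym (ℕ.+-assoc x _ _))

countOdd-++ : ∀ xs ys → countOdd (xs ++ ys) ≡ countOdd xs ℕ.+ countOdd ys
countOdd-++ []       ys = refl
countOdd-++ (x ∷ xs) ys =
  trans (cong (x % 2 ℕ.+_) (countOdd-++ xs ys)) (sym (ℕ.+-assoc (x % 2) _ _))

sumℤ-++ : ∀ xs ys → sumℤ (xs ++ ys) ≡ sumℤ xs + sumℤ ys
sumℤ-++ []       ys = sym (ℤ.+-identityˡ _)
sumℤ-++ (x ∷ xs) ys = trans (cong (λ s → x + s) (sumℤ-++ xs ys)) (sym (ℤ.+-assoc x _ _))

sumℤ-applyUpTo-suc : ∀ (g : ℕ → ℤ) n →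
  sumℤ (applyUpTo g (suc n)) ≡ sumℤ (applyUpTo g n) + g n
sumℤ-applyUpTo-suc g n = begin
  sumℤ (applyUpTo g (suc n))           ≡⟨ cong sumℤ (List.applyUpTo-∷ʳ g n) ⟨
  sumℤ (applyUpTo g n ∷ʳ g n)          ≡⟨ sumℤ-++ (applyUpTo g n) _ ⟩
  sumℤ (applyUpTo g n) + (g n + + 0)   ≡⟨ cong (λ s → sumℤ (applyUpTo g n) + s) (ℤ.+-identityʳ (g n)) ⟩
  sumℤ (applyUpTo g n) + g n           ∎
  where open ≡-Reasoning

sumℤ-applyUpTo-vanishing : ∀ (g : ℕ → ℤ) n → (∀ i → i < n → g i ≡ + 0) →
  sumℤ (applyUpTo g n) ≡ + 0
sumℤ-applyUpTo-vanishing g zero    _   = refl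
sumℤ-applyUpTo-vanishing g (suc n) g≡0 = cong₂ _+_ (g≡0 0 (s≤s z≤n))
  (sumℤ-applyUpTo-vanishing (λ i → g (suc i)) n (λ i i<n → g≡0 (suc i) (s≤s i<n)))

sumℤ-applyUpTo-window : ∀ (g w : ℕ → ℤ) j n →
  (∀ i → i < j → g i ≡ + 0) → (∀ i → g (i ℕ.+ j) ≡ w i) →
  sumℤ (applyUpTo g (n ℕ.+ j)) ≡ sumℤ (applyUpTo w n)
sumℤ-applyUpTo-window g w j zero    g≡0 _   = sumℤ-applyUpTo-vanishing g j g≡0
sumℤ-applyUpTo-window g w j (suc n) g≡0 g≡w = begin
  sumℤ (applyUpTo g (suc n ℕ.+ j))              ≡⟨ sumℤ-applyUpTo-suc g (n ℕ.+ j) ⟩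
  sumℤ (applyUpTo g (n ℕ.+ j)) + g (n ℕ.+ j)    ≡⟨ cong₂ _+_ (sumℤ-applyUpTo-window g w j n g≡0 g≡w) (g≡w n) ⟩
  sumℤ (applyUpTo w n) + w n                    ≡⟨ sumℤ-applyUpTo-suc w n ⟨
  sumℤ (applyUpTo w (suc n))                    ∎
  where open ≡-Reasoning

poly-beyond-degree : ∀ c0 c1 c2 c3 i j → i < j → poly c0 c1 c2 c3 (3 ℕ.+ j ∸ i) ≡ + 0
poly-beyond-degree c0 c1 c2 c3 zero    (suc j) _         = refl
poly-beyond-degree c0 c1 c2 c3 (suc i) (suc j) (s≤s i<j) = poly-beyond-degree c0 c1 c2 c3 i j i<j

⊛-poly-from-3 : ∀ (a : Series) c0 c1 c2 c3 j →
  (a ⊛ poly c0 c1 c2 c3) (3 ℕ.+ j)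
    ≡ a j * c3 + (a (1 ℕ.+ j) * c2 + (a (2 ℕ.+ j) * c1 + (a (3 ℕ.+ j) * c0 + + 0)))
⊛-poly-from-3 a c0 c1 c2 c3 j = begin
  sumℤ (map term (upTo (4 ℕ.+ j)))   ≡⟨ cong sumℤ (List.map-upTo term (4 ℕ.+ j)) ⟩
  sumℤ (applyUpTo term (4 ℕ.+ j))    ≡⟨ sumℤ-applyUpTo-window term shifted j 4 term≡0 term≡shifted ⟩
  sumℤ (applyUpTo shifted 4)         ∎
  where
  open ≡-Reasoning
  p : Series
  p = poly c0 c1 c2 c3
  term shifted : ℕ → ℤ
  term i    = a i * p (3 ℕ.+ j ∸ i)
  shifted i = a (i ℕ.+ j) * p (3 ∸ i)
  term≡0 : ∀ i → i < j → term i ≡ + 0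
  term≡0 i i<j = trans (cong (a i *_) (poly-beyond-degree c0 c1 c2 c3 i j i<j)) (ℤ.*-zeroʳ (a i))
  term≡shifted : ∀ i → term (i ℕ.+ j) ≡ shifted i
  term≡shifted i = cong (λ t → a (i ℕ.+ j) * p t) (begin
    3 ℕ.+ j ∸ (i ℕ.+ j)  ≡⟨ cong₂ _∸_ (ℕ.+-comm 3 j) (ℕ.+-comm i j) ⟩
    j ℕ.+ 3 ∸ (j ℕ.+ i)  ≡⟨ ℕ.[m+n]∸[m+o]≡n∸o j 3 i ⟩
    3 ∸ i                ∎)

poly-cubic-free-from-3 : ∀ c0 c1 c2 j → poly c0 c1 c2 (+ 0) (3 ℕ.+ j) ≡ + 0
poly-cubic-free-from-3 c0 c1 c2 zero    = refl
poly-cubic-free-from-3 c0 c1 c2 (suc j) = refl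

⊛-recurrence : ∀ (a : Series) c1 c2 c3 → a 0 ≡ + 1 →
  (∀ j → a (3 ℕ.+ j) ≡ c1 * a (2 ℕ.+ j) + c2 * a (1 ℕ.+ j) + c3 * a j) →
  ∀ n → (a ⊛ poly (+ 1) (- c1) (- c2) (- c3)) n
          ≡ poly (+ 1) (a 1 - c1) (a 2 - c1 * a 1 - c2) (+ 0) n
⊛-recurrence a c1 c2 c3 a₀ rec zero = cong (λ u → u * + 1 + + 0) a₀
⊛-recurrence a c1 c2 c3 a₀ rec 1 =
  trans (cong (λ u → u * - c1 + (a 1 * + 1 + + 0)) a₀) (identity c1 (a 1))
  where
  identity : ∀ c x → + 1 * - c + (x * + 1 + + 0) ≡ x - c
  identity = solve-∀
⊛-recurrence a c1 c2 c3 a₀ rec 2 =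
  trans (cong (λ u → u * - c2 + (a 1 * - c1 + (a 2 * + 1 + + 0))) a₀) (identity c1 c2 (a 1) (a 2))
  where
  identity : ∀ c c′ x y → + 1 * - c′ + (x * - c + (y * + 1 + + 0)) ≡ y - c * x - c′
  identity = solve-∀
⊛-recurrence a c1 c2 c3 a₀ rec (suc (suc (suc j))) = begin
  (a ⊛ poly (+ 1) (- c1) (- c2) (- c3)) (3 ℕ.+ j)
    ≡⟨ ⊛-poly-from-3 a (+ 1) (- c1) (- c2) (- c3) j ⟩
  a j * - c3 + (a (1 ℕ.+ j) * - c2 + (a (2 ℕ.+ j) * - c1 + (a (3 ℕ.+ j) * + 1 + + 0)))
    ≡⟨ cong (λ u → a j * - c3 + (a (1 ℕ.+ j) * - c2 + (a (2 ℕ.+ j) * - c1 + (u * + 1 + + 0)))) (rec j) ⟩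
  a j * - c3 + (a (1 ℕ.+ j) * - c2 + (a (2 ℕ.+ j) * - c1 + ((c1 * a (2 ℕ.+ j) + c2 * a (1 ℕ.+ j) + c3 * a j) * + 1 + + 0)))
    ≡⟨ cancel c1 c2 c3 (a j) (a (1 ℕ.+ j)) (a (2 ℕ.+ j)) ⟩
  + 0
    ≡⟨ poly-cubic-free-from-3 (+ 1) (a 1 - c1) (a 2 - c1 * a 1 - c2) j ⟨
  poly (+ 1) (a 1 - c1) (a 2 - c1 * a 1 - c2) (+ 0) (3 ℕ.+ j) ∎
  where
  open ≡-Reasoning
  cancel : ∀ c c′ c″ x y w →
    x * - c″ + (y * - c′ + (w * - c + ((c * w + c′ * y + c″ * x) * + 1 + + 0))) ≡ + 0
  cancel = solve-∀

Positive : List ℕ → Set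
Positive = All (1 ≤_)

module _ {R : ℕ → List ℕ} where

  length-concatMap : (∀ k → length (R k) ≡ k) → ∀ L → length (concatMap R L) ≡ sumℕ L
  length-concatMap len-R []      = refl
  length-concatMap len-R (k ∷ L) =
    trans (List.length-++ (R k)) (cong₂ ℕ._+_ (len-R k) (length-concatMap len-R L))

  concatMap-positive : (∀ k → 1 ≤ k → Positive (R k)) → ∀ {L} → Positive L → Positive (concatMap R L)
  concatMap-positive pos-R pos-L = All.concat⁺ (All.map⁺ (All.map (λ {k} → pos-R k) pos-L))

  countOdd-concatMap : ∀ {m} → (∀ k → 1 ≤ k → countOdd (R k) ≡ m) →
    ∀ {L} → Positive L → countOdd (concatMap R L) ≡ m ℕ.* length L
  countOdd-concatMap {m} odd-R All.[] = sym (ℕ.*-zeroʳ m)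
  countOdd-concatMap {m} odd-R {k ∷ L} (1≤k All.∷ pos-L) = begin
    countOdd (R k ++ concatMap R L)              ≡⟨ countOdd-++ (R k) _ ⟩
    countOdd (R k) ℕ.+ countOdd (concatMap R L)  ≡⟨ cong₂ ℕ._+_ (odd-R k 1≤k) (countOdd-concatMap odd-R pos-L) ⟩
    m ℕ.+ m ℕ.* length L                         ≡⟨ ℕ.*-suc m (length L) ⟨
    m ℕ.* suc (length L)                         ∎
    where open ≡-Reasoning

  sumℕ-concatMap : ∀ α β δ → (∀ k → 1 ≤ k → + sumℕ (R k) ≡ α * + k + β + δ * + (k % 2)) →
    ∀ {L} → Positive L → + sumℕ (concatMap R L) ≡ α * + sumℕ L + β * + length L + δ * + countOdd L
  sumℕ-concatMap α β δ sum-R All.[] = sym (identity α β δ)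
    where
    identity : ∀ a b d → a * + 0 + b * + 0 + d * + 0 ≡ + 0
    identity = solve-∀
  sumℕ-concatMap α β δ sum-R {k ∷ L} (1≤k All.∷ pos-L) = begin
    + sumℕ (R k ++ concatMap R L)
      ≡⟨ cong +_ (sumℕ-++ (R k) _) ⟩
    + (sumℕ (R k) ℕ.+ sumℕ (concatMap R L))
      ≡⟨ ℤ.pos-+ (sumℕ (R k)) _ ⟩
    + sumℕ (R k) + + sumℕ (concatMap R L)
      ≡⟨ cong₂ _+_ (sum-R k 1≤k) (sumℕ-concatMap α β δ sum-R pos-L) ⟩
    α * + k + β + δ * + (k % 2) + (α * + sumℕ L + β * + length L + δ * + countOdd L)
      ≡⟨ regroup α β δ (+ k) (+ (k % 2)) (+ sumℕ L) (+ length L) (+ countOdd L) ⟩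
    α * (+ k + + sumℕ L) + β * (+ 1 + + length L) + δ * (+ (k % 2) + + countOdd L)
      ≡⟨ cong₂ (λ u v → α * u + β * + suc (length L) + δ * v) (ℤ.pos-+ k _) (ℤ.pos-+ (k % 2) _) ⟨
    α * + sumℕ (k ∷ L) + β * + length (k ∷ L) + δ * + countOdd (k ∷ L)
      ∎
    where
    open ≡-Reasoning
    regroup : ∀ a b d x p s l c → a * x + b + d * p + (a * s + b * l + d * c)
                ≡ a * (x + s) + b * (+ 1 + l) + d * (p + c)
    regroup = solve-∀

even⊎odd : ∀ k → Even k ⊎ Odd k
even⊎odd k with k % 2 | m%n<n k 2
... | 0           | _                 = inj₁ refl
... | 1           | _                 = inj₂ refl
... | suc (suc _) | s≤s (s≤s ())

module _ (e0 e1 : (k : ℕ) → Vec ℕ k) where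

  rule-even : ∀ {k} → Even k → rule e0 e1 k ≡ toList (e0 k)
  rule-even {k} even = cong (λ r → if r ℕ.≡ᵇ 0 then toList (e0 k) else toList (e1 k)) even

  rule-odd : ∀ {k} → Odd k → rule e0 e1 k ≡ toList (e1 k)
  rule-odd {k} odd = cong (λ r → if r ℕ.≡ᵇ 0 then toList (e0 k) else toList (e1 k)) odd

  length-rule : ∀ k → length (rule e0 e1 k) ≡ k
  length-rule k with even⊎odd k
  ... | inj₁ even = trans (cong length (rule-even even)) (length-toList (e0 k))
  ... | inj₂ odd  = trans (cong length (rule-odd odd)) (length-toList (e1 k))

  rule-positive :
    (∀ k → 1 ≤ k → Even k → Positive (toList (e0 k))) →
    (∀ k → 1 ≤ k → Odd k → Positive (toList (e1 k))) →
    ∀ k → 1 ≤ k → Positive (rule e0 e1 k)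
  rule-positive pos0 pos1 k 1≤k with even⊎odd k
  ... | inj₁ even = subst Positive (sym (rule-even even)) (pos0 k 1≤k even)
  ... | inj₂ odd  = subst Positive (sym (rule-odd odd)) (pos1 k 1≤k odd)

  countOdd-rule : ∀ {m} →
    (∀ k → 1 ≤ k → Even k → countOdd (toList (e0 k)) ≡ m) →
    (∀ k → 1 ≤ k → Odd k → countOdd (toList (e1 k)) ≡ m) →
    ∀ k → 1 ≤ k → countOdd (rule e0 e1 k) ≡ m
  countOdd-rule odd0 odd1 k 1≤k with even⊎odd k
  ... | inj₁ even = trans (cong countOdd (rule-even even)) (odd0 k 1≤k even)
  ... | inj₂ odd  = trans (cong countOdd (rule-odd odd)) (odd1 k 1≤k odd)

  sumℕ-rule : ∀ α β0 β1 →
    (∀ k → 1 ≤ k → Even k → + sumℕ (toList (e0 k)) ≡ α * + k + β0) →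
    (∀ k → 1 ≤ k → Odd k → + sumℕ (toList (e1 k)) ≡ α * + k + β1) →
    ∀ k → 1 ≤ k → + sumℕ (rule e0 e1 k) ≡ α * + k + β0 + (β1 - β0) * + (k % 2)
  sumℕ-rule α β0 β1 σ0 σ1 k 1≤k with even⊎odd k
  ... | inj₁ even = begin
    + sumℕ (rule e0 e1 k)                         ≡⟨ cong (λ ks → + sumℕ ks) (rule-even even) ⟩
    + sumℕ (toList (e0 k))                        ≡⟨ σ0 k 1≤k even ⟩
    α * + k + β0                                  ≡⟨ identity (α * + k) β0 β1 ⟩
    α * + k + β0 + (β1 - β0) * + 0                ≡⟨ cong (λ r → α * + k + β0 + (β1 - β0) * + r) even ⟨
    α * + k + β0 + (β1 - β0) * + (k % 2)          ∎
    where
    open ≡-Reasoning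
    identity : ∀ x b b′ → x + b ≡ x + b + (b′ - b) * + 0
    identity = solve-∀
  ... | inj₂ odd = begin
    + sumℕ (rule e0 e1 k)                         ≡⟨ cong (λ ks → + sumℕ ks) (rule-odd odd) ⟩
    + sumℕ (toList (e1 k))                        ≡⟨ σ1 k 1≤k odd ⟩
    α * + k + β1                                  ≡⟨ identity (α * + k) β0 β1 ⟩
    α * + k + β0 + (β1 - β0) * + 1                ≡⟨ cong (λ r → α * + k + β0 + (β1 - β0) * + r) odd ⟨
    α * + k + β0 + (β1 - β0) * + (k % 2)          ∎
    where
    open ≡-Reasoning
    identity : ∀ x b b′ → x + b′ ≡ x + b + (b′ - b) * + 1
    identity = solve-∀

f-suc : ∀ s0 e0 e1 n → f s0 e0 e1 (suc n) ≡ sumℕ (level s0 e0 e1 n)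
f-suc s0 e0 e1 n = length-concatMap (length-rule e0 e1) (level s0 e0 e1 n)

module _ (s0 : ℕ) (e0 e1 : (k : ℕ) → Vec ℕ k) (α β0 β1 : ℤ) (m : ℕ)
    (1≤s0 : 1 ≤ s0)
    (pos0 : ∀ k → 1 ≤ k → Even k → Positive (toList (e0 k)))
    (pos1 : ∀ k → 1 ≤ k → Odd k → Positive (toList (e1 k)))
    (σ0 : ∀ k → 1 ≤ k → Even k → + sumℕ (toList (e0 k)) ≡ α * + k + β0)
    (σ1 : ∀ k → 1 ≤ k → Odd k → + sumℕ (toList (e1 k)) ≡ α * + k + β1)
    (odd0 : ∀ k → 1 ≤ k → Even k → countOdd (toList (e0 k)) ≡ m)
    (odd1 : ∀ k → 1 ≤ k → Odd k → countOdd (toList (e1 k)) ≡ m) where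

  private
    R : ℕ → List ℕ
    R = rule e0 e1

    level′ : ℕ → List ℕ
    level′ = level s0 e0 e1

    a : Series
    a = F s0 e0 e1

  level-positive : ∀ n → Positive (level′ n)
  level-positive zero    = 1≤s0 All.∷ All.[]
  level-positive (suc n) = concatMap-positive (rule-positive e0 e1 pos0 pos1) (level-positive n)

  countOdd-level-suc : ∀ n → countOdd (level′ (suc n)) ≡ m ℕ.* f s0 e0 e1 n
  countOdd-level-suc n = countOdd-concatMap (countOdd-rule e0 e1 odd0 odd1) (level-positive n)

  F-recurrence : ∀ j → a (3 ℕ.+ j) ≡ α * a (2 ℕ.+ j) + β0 * a (1 ℕ.+ j) + (+ m * (β1 - β0)) * a j
  F-recurrence j = begin
    + f s0 e0 e1 (3 ℕ.+ j)
      ≡⟨ cong +_ (f-suc s0 e0 e1 (2 ℕ.+ j)) ⟩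
    + sumℕ (concatMap R (level′ (1 ℕ.+ j)))
      ≡⟨ sumℕ-concatMap α β0 (β1 - β0) (sumℕ-rule e0 e1 α β0 β1 σ0 σ1) (level-positive (1 ℕ.+ j)) ⟩
    α * + sumℕ (level′ (1 ℕ.+ j)) + β0 * a (1 ℕ.+ j) + (β1 - β0) * + countOdd (level′ (1 ℕ.+ j))
      ≡⟨ cong₂ (λ u v → α * + u + β0 * a (1 ℕ.+ j) + (β1 - β0) * + v)
           (sym (f-suc s0 e0 e1 (1 ℕ.+ j))) (countOdd-level-suc j) ⟩
    α * a (2 ℕ.+ j) + β0 * a (1 ℕ.+ j) + (β1 - β0) * + (m ℕ.* f s0 e0 e1 j)
      ≡⟨ cong (λ u → α * a (2 ℕ.+ j) + β0 * a (1 ℕ.+ j) + u) correction ⟩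
    α * a (2 ℕ.+ j) + β0 * a (1 ℕ.+ j) + (+ m * (β1 - β0)) * a j
      ∎
    where
    open ≡-Reasoning
    reassociate : ∀ d c x → d * (c * x) ≡ (c * d) * x
    reassociate = solve-∀
    correction : (β1 - β0) * + (m ℕ.* f s0 e0 e1 j) ≡ (+ m * (β1 - β0)) * a j
    correction = trans (cong ((β1 - β0) *_) (ℤ.pos-* m _)) (reassociate (β1 - β0) (+ m) (a j))

proposition3 : (s0 : ℕ) (e0 e1 : (k : ℕ) → Vec ℕ k) (α β0 β1 : ℤ) (m : ℕ)
    → 1 ≤ s0
    → (∀ k → 1 ≤ k → Even k → All (λ x → 1 ≤ x) (toList (e0 k)))
    → (∀ k → 1 ≤ k → Odd k → All (λ x → 1 ≤ x) (toList (e1 k)))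
    → (∀ k → 1 ≤ k → Even k → + (sumℕ (toList (e0 k))) ≡ α * + k + β0)
    → (∀ k → 1 ≤ k → Odd k → + (sumℕ (toList (e1 k))) ≡ α * + k + β1)
    → (∀ k → 1 ≤ k → Even k → countOdd (toList (e0 k)) ≡ m)
    → (∀ k → 1 ≤ k → Odd k → countOdd (toList (e1 k)) ≡ m)
    → let s1 = + (sumℕ (level s0 e0 e1 1)) in
    ∀ n → (F s0 e0 e1 ⊛ poly (+ 1) (- α) (- β0) (- (+ m * (β1 - β0)))) n
    ≡ poly (+ 1) (+ s0 - α) (s1 - α * + s0 - β0) (+ 0) n
proposition3 s0 e0 e1 α β0 β1 m 1≤s0 pos0 pos1 σ0 σ1 odd0 odd1 n =
  trans (⊛-recurrence (F s0 e0 e1) α β0 (+ m * (β1 - β0)) refl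
           (F-recurrence s0 e0 e1 α β0 β1 m 1≤s0 pos0 pos1 σ0 σ1 odd0 odd1) n)
        (cong₂ (λ u v → poly (+ 1) (u - α) (v - α * u - β0) (+ 0) n) F₁ F₂)
  where
  F₁ : F s0 e0 e1 1 ≡ + s0
  F₁ = cong +_ (trans (f-suc s0 e0 e1 0) (ℕ.+-identityʳ s0))
  F₂ : F s0 e0 e1 2 ≡ + sumℕ (level s0 e0 e1 1)
  F₂ = cong +_ (f-suc s0 e0 e1 1)
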